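{- Let $G=(V,E)$ be a connected Eulerian digraph and let $N$ be the maximum number of arcs of an acyclic arc set of $G$. Then for every vertex $s$ of $G$ there is an acyclic arc set of $G$ with $N$ arcs that contains no arc whose head is $s$.
   Context: Digraphs are finite and simple. A digraph is Eulerian if every vertex has in-degree equal to out-degree. For $A\subseteq E$, $G[A]$ denotes the digraph with vertex set $V$ and arc set $A$. An acyclic arc set of $G$ is a subset $A\subseteq E$ such that $G[A]$ has no directed cycle. -}

module Defs where

open import Data.Nat using (ℕ; zero; suc)
open import Data.Fin using (Fin; _≟_)
open import Data.Product using (_×_; _,_; proj₁; proj₂; Σ)
open import Data.List using (List; length; filter)
open import Data.List.Membership.Propositional using (_∈_)
open import Data.List.Relation.Unary.All using (All)
open import Data.List.Relation.Unary.Unique.Propositional using (Unique)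
open import Relation.Binary.PropositionalEquality using (_≡_; _≢_)
open import Relation.Nullary using (¬_)

-- A finite digraph on vertex set Fin n, with arcs given as (tail , head) pairs.
Arc : ℕ → Set
Arc n = Fin n × Fin n

record Digraph : Set where
  field
    n     : ℕ
    arcs  : List (Arc n)
    arcs-unique : Unique arcs
    no-loops    : All (λ e → proj₁ e ≢ proj₂ e) arcs

open Digraph public

outdeg : (G : Digraph) → Fin (n G) → ℕ
outdeg G v = length (filter (λ e → proj₁ e ≟ v) (arcs G))

indeg : (G : Digraph) → Fin (n G) → ℕ
indeg G v = length (filter (λ e → proj₂ e ≟ v) (arcs G))

Eulerian : Digraph → Set
Eulerian G = ∀ v → indeg G v ≡ outdeg G v

data UWalk {m : ℕ} (E : List (Arc m)) : Fin m → Fin m → Set where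
  here : ∀ {v} → UWalk E v v
  fwd  : ∀ {u w v} → (u , w) ∈ E → UWalk E w v → UWalk E u v
  bwd  : ∀ {u w v} → (w , u) ∈ E → UWalk E w v → UWalk E u v

-- connected digraph = underlying undirected graph connected
Connected : Digraph → Set
Connected G = ∀ u v → UWalk (arcs G) u v

data Walk {m : ℕ} (A : List (Arc m)) : Fin m → Fin m → ℕ → Set where
  nil  : ∀ {v} → Walk A v v 0
  cons : ∀ {u w v k} → (u , w) ∈ A → Walk A w v k → Walk A u v (suc k)

HasDirectedCycle : {m : ℕ} → List (Arc m) → Set
HasDirectedCycle {m} A = Σ (Fin m) λ v → Σ ℕ λ k → Walk A v v (suc k)

-- A ⊆ E, represented as a duplicate-free list of arcs of G
ArcSet : (G : Digraph) → List (Arc (n G)) → Set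
ArcSet G A = Unique A × All (_∈ arcs G) A

AcyclicArcSet : (G : Digraph) → List (Arc (n G)) → Set
AcyclicArcSet G A = ArcSet G A × ¬ HasDirectedCycle A

-- Every ranking r : V → ℕ of the vertices determines the set of
-- its forward arcs (those u → w with r u < r w); such a set is always
-- acyclic, and conversely every acyclic arc set B is contained in the
-- forward set of a topological ranking of B.  Hence a maximum acyclic arc
-- set is the forward set of a ranking maximising the number of forward
-- arcs; since rankings bounded by |E| suffice, they form a finite family
-- and such a maximiser exists.  Given s, raise every vertex ranked below s
-- above all other vertices (keeping their relative order).  Arcs inside
-- the raised set or inside its complement keep their status, arcs leaving
-- the raised set become backward and arcs entering it become forward; in
-- an Eulerian digraph both cut counts agree, so the number of forward arcs
-- is unchanged.  After raising, s has minimum rank, so no forward arc ends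
-- in s.

module Submission where

open import Defs
open import Algebra.Properties.CommutativeSemigroup using (interchange)
open import Data.Bool using (true; false; if_then_else_)
open import Data.Empty using (⊥; ⊥-elim)
open import Data.Fin as Fin using (Fin; toℕ; fromℕ<; _≟_)
open import Data.Fin.Properties using (any?; pigeonhole; toℕ<n; toℕ-fromℕ<)
open import Data.List using (List; []; _∷_; length; filter; _++_; map; allFin; concatMap)
open import Data.List.Properties using (length-++; filter-notAll; filter-none; filter-≐; map-cong)
open import Data.List.Membership.Propositional using (_∈_; find)
open import Data.List.Membership.Propositional.Properties
  using (∈-filter⁺; ∈-filter⁻; ∈-∃++; ∈-++⁻; ∈-++⁺ˡ; ∈-++⁺ʳ; ∈-allFin; ∈-concatMap⁺; ∈-map⁺)
open import Data.List.Relation.Unary.All as All using (All; _∷_)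
open import Data.List.Relation.Unary.Any as Any using (Any; here; there)
open import Data.List.Relation.Unary.AllPairs using (_∷_)
open import Data.List.Relation.Unary.Unique.Propositional using (Unique)
open import Data.List.Relation.Unary.Unique.Propositional.Properties using (filter⁺; allFin⁺)
open import Data.Nat using (ℕ; zero; suc; _+_; _∸_; _≤_; _<_; z≤n; s≤s; _<?_)
open import Data.Nat.ListAction using (sum)
open import Data.Nat.Properties hiding (_≟_; _<?_)
open import Data.Product using (_×_; _,_; proj₁; proj₂; Σ)
open import Data.Sum using (inj₁; inj₂)
open import Data.Vec using (Vec; []; _∷_; lookup; tabulate; replicate)
open import Data.Vec.Properties using (lookup∘tabulate)
open import Function using (_∘_)
open import Relation.Binary.PropositionalEquality
open import Relation.Nullary using (¬_; Dec; yes; no; does; ¬?)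
open import Relation.Nullary.Decidable using (_×-dec_; _⊎-dec_)
open import Relation.Unary using (Decidable)

open import Data.List.Extrema ≤-totalOrder using (argmax; f[xs]≤f[argmax])

ind : ∀ {p} {P : Set p} → Dec P → ℕ
ind d = if does d then 1 else 0

ind-yes : ∀ {p} {P : Set p} (d : Dec P) → P → ind d ≡ 1
ind-yes (yes _) _ = refl
ind-yes (no ¬p) p = ⊥-elim (¬p p)

ind-no : ∀ {p} {P : Set p} (d : Dec P) → ¬ P → ind d ≡ 0
ind-no (yes p) ¬p = ⊥-elim (¬p p)
ind-no (no _) _ = refl

ind-cong : ∀ {p q} {P : Set p} {Q : Set q} → (P → Q) → (Q → P) →
  (d : Dec P) (e : Dec Q) → ind d ≡ ind e
ind-cong f g (yes p) e = sym (ind-yes e (f p))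
ind-cong f g (no ¬p) e = sym (ind-no e (¬p ∘ g))

count : ∀ {a p} {A : Set a} {P : A → Set p} → Decidable P → List A → ℕ
count P? xs = length (filter P? xs)

count-∷ : ∀ {a p} {A : Set a} {P : A → Set p} (P? : Decidable P) x xs →
  count P? (x ∷ xs) ≡ ind (P? x) + count P? xs
count-∷ P? x xs with does (P? x)
... | true = refl
... | false = refl

count-balance : ∀ {a} {A : Set a} {P Q P′ Q′ : A → Set}
  (p : Decidable P) (q : Decidable Q) (p′ : Decidable P′) (q′ : Decidable Q′) →
  (∀ x → ind (p x) + ind (q x) ≡ ind (p′ x) + ind (q′ x)) → ∀ xs →
  count p xs + count q xs ≡ count p′ xs + count q′ xs
count-balance p q p′ q′ h [] = refl
count-balance p q p′ q′ h (x ∷ xs) = begin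
  count p (x ∷ xs) + count q (x ∷ xs)
    ≡⟨ cong₂ _+_ (count-∷ p x xs) (count-∷ q x xs) ⟩
  (ind (p x) + count p xs) + (ind (q x) + count q xs)
    ≡⟨ interchange +-commutativeSemigroup (ind (p x)) _ _ _ ⟩
  (ind (p x) + ind (q x)) + (count p xs + count q xs)
    ≡⟨ cong₂ _+_ (h x) (count-balance p q p′ q′ h xs) ⟩
  (ind (p′ x) + ind (q′ x)) + (count p′ xs + count q′ xs)
    ≡⟨ interchange +-commutativeSemigroup (ind (p′ x)) _ _ _ ⟩
  (ind (p′ x) + count p′ xs) + (ind (q′ x) + count q′ xs)
    ≡⟨ sym (cong₂ _+_ (count-∷ p′ x xs) (count-∷ q′ x xs)) ⟩
  count p′ (x ∷ xs) + count q′ (x ∷ xs) ∎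
  where open ≡-Reasoning

count-⊎ : ∀ {a} {A : Set a} {P Q : A → Set} (p : Decidable P) (q : Decidable Q) →
  (∀ x → P x → Q x → ⊥) → ∀ xs →
  count (λ x → p x ⊎-dec q x) xs ≡ count p xs + count q xs
count-⊎ p q disjoint [] = refl
count-⊎ p q disjoint (x ∷ xs) = begin
  count p⊎q (x ∷ xs)                                  ≡⟨ count-∷ p⊎q x xs ⟩
  ind (p⊎q x) + count p⊎q xs                          ≡⟨ cong₂ _+_ (ind-⊎ (p x) (q x) (disjoint x))
                                                                   (count-⊎ p q disjoint xs) ⟩
  (ind (p x) + ind (q x)) + (count p xs + count q xs) ≡⟨ interchange +-commutativeSemigroup (ind (p x)) _ _ _ ⟩
  (ind (p x) + count p xs) + (ind (q x) + count q xs) ≡⟨ sym (cong₂ _+_ (count-∷ p x xs) (count-∷ q x xs)) ⟩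
  count p (x ∷ xs) + count q (x ∷ xs)                 ∎
  where
  open ≡-Reasoning
  p⊎q = λ x → p x ⊎-dec q x
  ind-⊎ : ∀ {P Q : Set} (d : Dec P) (e : Dec Q) → (P → Q → ⊥) → ind (d ⊎-dec e) ≡ ind d + ind e
  ind-⊎ (yes p) (yes q) disj = ⊥-elim (disj p q)
  ind-⊎ (yes _) (no _) _ = refl
  ind-⊎ (no _) (yes _) _ = refl
  ind-⊎ (no _) (no _) _ = refl

count-∈ : ∀ {a m} {X : Set a} (f : X → Fin m) (E : List X) {vs : List (Fin m)} → Unique vs →
  count (λ x → Any.any? (f x ≟_) vs) E ≡ sum (map (λ v → count (λ x → f x ≟ v) E) vs)
count-∈ f E {[]} _ = cong length (filter-none _ (All.tabulate {xs = E} λ _ ()))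
count-∈ f E {v ∷ vs} (v∉vs ∷ uvs) = begin
  count (λ x → Any.any? (f x ≟_) (v ∷ vs)) E
    ≡⟨ cong length (filter-≐ _ _ ((λ { (here e) → inj₁ e ; (there i) → inj₂ i })
                                 , λ { (inj₁ e) → here e ; (inj₂ i) → there i }) E) ⟩
  count (λ x → (f x ≟ v) ⊎-dec Any.any? (f x ≟_) vs) E
    ≡⟨ count-⊎ (λ x → f x ≟ v) (λ x → Any.any? (f x ≟_) vs)
               (λ { x refl i → All.lookup v∉vs i refl }) E ⟩
  count (λ x → f x ≟ v) E + count (λ x → Any.any? (f x ≟_) vs) E
    ≡⟨ cong (count (λ x → f x ≟ v) E +_) (count-∈ f E uvs) ⟩
  sum (map (λ v → count (λ x → f x ≟ v) E) (v ∷ vs)) ∎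
  where open ≡-Reasoning

eulerian-cut : ∀ (G : Digraph) → Eulerian G → {S : Fin (n G) → Set} (S? : Decidable S) →
  count (λ e → S? (proj₂ e)) (arcs G) ≡ count (λ e → S? (proj₁ e)) (arcs G)
eulerian-cut G eul S? = begin
  count (λ e → S? (proj₂ e)) E                                 ≡⟨ as-membership proj₂ ⟩
  count (λ e → Any.any? (proj₂ e ≟_) vs) E                     ≡⟨ count-∈ proj₂ E unique-vs ⟩
  sum (map (λ v → count (λ e → proj₂ e ≟ v) E) vs)             ≡⟨ cong sum (map-cong eul vs) ⟩
  sum (map (λ v → count (λ e → proj₁ e ≟ v) E) vs)             ≡⟨ sym (count-∈ proj₁ E unique-vs) ⟩
  count (λ e → Any.any? (proj₁ e ≟_) vs) E                     ≡⟨ sym (as-membership proj₁) ⟩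
  count (λ e → S? (proj₁ e)) E                                 ∎
  where
  open ≡-Reasoning
  E = arcs G
  vs = filter S? (allFin (n G))
  unique-vs : Unique vs
  unique-vs = filter⁺ S? (allFin⁺ (n G))
  as-membership : (f : Arc (n G) → Fin (n G)) →
    count (λ e → S? (f e)) E ≡ count (λ e → Any.any? (f e ≟_) vs) E
  as-membership f = cong length (filter-≐ _ _
    ((λ {e} s → ∈-filter⁺ S? (∈-allFin (f e)) s) , λ i → proj₂ (∈-filter⁻ S? {xs = allFin (n G)} i)) E)

unique-length-≤ : ∀ {a} {A : Set a} {xs ys : List A} → Unique xs → All (_∈ ys) xs →
  length xs ≤ length ys
unique-length-≤ {xs = []} _ _ = z≤n
unique-length-≤ {xs = x ∷ xs} (x∉xs ∷ uxs) (x∈ys ∷ xs⊆ys) with ∈-∃++ x∈ys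
... | as , bs , refl = begin
    suc (length xs)             ≤⟨ s≤s (unique-length-≤ uxs (All.tabulate λ y∈xs →
                                     drop-x (All.lookup xs⊆ys y∈xs) (All.lookup x∉xs y∈xs ∘ sym))) ⟩
    suc (length (as ++ bs))     ≡⟨ cong suc (length-++ as) ⟩
    suc (length as + length bs) ≡⟨ sym (+-suc (length as) (length bs)) ⟩
    length as + length (x ∷ bs) ≡⟨ sym (length-++ as) ⟩
    length (as ++ x ∷ bs)       ∎
  where
  open ≤-Reasoning
  drop-x : ∀ {y} → y ∈ as ++ x ∷ bs → y ≢ x → y ∈ as ++ bs
  drop-x y∈ y≢x with ∈-++⁻ as y∈
  ... | inj₁ y∈as = ∈-++⁺ˡ y∈as
  ... | inj₂ (here y≡x) = ⊥-elim (y≢x y≡x)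
  ... | inj₂ (there y∈bs) = ∈-++⁺ʳ as y∈bs

walk-mono : ∀ {m} {A B : List (Arc m)} → (∀ {e} → e ∈ A → e ∈ B) →
  ∀ {u v k} → Walk A u v k → Walk B u v k
walk-mono A⊆B nil = nil
walk-mono A⊆B (cons a w) = cons (A⊆B a) (walk-mono A⊆B w)

cycle-mono : ∀ {m} {A B : List (Arc m)} → (∀ {e} → e ∈ A → e ∈ B) →
  HasDirectedCycle A → HasDirectedCycle B
cycle-mono A⊆B (v , k , w) = v , k , walk-mono A⊆B w

closed-walk-cycle : ∀ {m} {B : List (Arc m)} {v d} → Walk B v v d → 0 < d → HasDirectedCycle B
closed-walk-cycle w@(cons _ _) _ = _ , _ , w

Increasing : ∀ {m} → (Fin m → ℕ) → List (Arc m) → Set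
Increasing r B = ∀ {u w} → (u , w) ∈ B → r u < r w

walk-increasing : ∀ {m} {B : List (Arc m)} (r : Fin m → ℕ) → Increasing r B →
  ∀ {u v k} → Walk B u v k → r u ≤ r v
walk-increasing r inc nil = ≤-refl
walk-increasing r inc (cons a w) = <⇒≤ (<-≤-trans (inc a) (walk-increasing r inc w))

increasing-acyclic : ∀ {m} {B : List (Arc m)} (r : Fin m → ℕ) → Increasing r B →
  ¬ HasDirectedCycle B
increasing-acyclic r inc (v , k , cons a w) = <-irrefl refl (<-≤-trans (inc a) (walk-increasing r inc w))

HasOut HasIn : ∀ {m} → List (Arc m) → Fin m → Set
HasOut B v = Any (λ e → proj₁ e ≡ v) B
HasIn B v = Any (λ e → proj₂ e ≡ v) B

-- If every vertex with an outgoing arc also has an incoming arc coming from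
-- a vertex with an outgoing arc, following arcs backwards forever must
-- revisit a vertex, which closes a directed cycle.
module BackwardChain {m} (B : List (Arc m))
  (pred : ∀ v → HasOut B v → Σ (Fin m) λ u → HasOut B u × (u , v) ∈ B) where

  Tail : Set
  Tail = Σ (Fin m) (HasOut B)

  back : Tail → Tail
  back (v , out) = proj₁ (pred v out) , proj₁ (proj₂ (pred v out))

  back-arc : ∀ t → (proj₁ (back t) , proj₁ t) ∈ B
  back-arc (v , out) = proj₂ (proj₂ (pred v out))

  chain : Tail → ℕ → Tail
  chain t zero = t
  chain t (suc k) = back (chain t k)

  chain-walk : ∀ t d i → Walk B (proj₁ (chain t (d + i))) (proj₁ (chain t i)) d
  chain-walk t zero i = nil
  chain-walk t (suc d) i = cons (back-arc (chain t (d + i))) (chain-walk t d i)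

  -- Among the first m + 1 vertices of the chain two coincide.
  cycle : Tail → HasDirectedCycle B
  cycle t with pigeonhole (n<1+n m) (λ i → proj₁ (chain t (toℕ i)))
  ... | i , j , i<j , same = closed-walk-cycle
        (subst (λ x → Walk B x (proj₁ (chain t (toℕ i))) (toℕ j ∸ toℕ i))
               (trans (cong (proj₁ ∘ chain t) (m∸n+n≡m (<⇒≤ i<j))) (sym same))
               (chain-walk t (toℕ j ∸ toℕ i) (toℕ i)))
        (m<n⇒0<n∸m i<j)

source : ∀ {m} (B : List (Arc m)) → ¬ HasDirectedCycle B → ∀ a → HasOut B a →
  Σ (Fin m) λ v → ¬ HasIn B v × HasOut B v
source B acyc a out-a
  with any? (λ v → ¬? (Any.any? (λ e → proj₂ e ≟ v) B) ×-dec Any.any? (λ e → proj₁ e ≟ v) B)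
... | yes found = found
... | no none = ⊥-elim (acyc (BackwardChain.cycle B pred (a , out-a)))
  where
  pred : ∀ v → HasOut B v → Σ (Fin _) λ u → HasOut B u × (u , v) ∈ B
  pred v out with Any.any? (λ e → proj₂ e ≟ v) B
  ... | no ¬in = ⊥-elim (none (v , ¬in , out))
  ... | yes in-v with find in-v
  ... | (u , _) , uv∈B , refl = u , Any.map (λ eq → cong proj₁ (sym eq)) uv∈B , uv∈B

below : ∀ {m} → Fin m → (Fin m → ℕ) → Fin m → ℕ
below v r w with w ≟ v
... | yes _ = 0
... | no _ = suc (r w)

not-leaving : ∀ {m} → Fin m → List (Arc m) → List (Arc m)
not-leaving v = filter (λ e → ¬? (proj₁ e ≟ v))

below-increasing : ∀ {m} {B : List (Arc m)} {v r} → ¬ HasIn B v →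
  Increasing r (not-leaving v B) → Increasing (below v r) B
below-increasing {v = v} {r} no-in inc {u} {w} uw∈B with w ≟ v | u ≟ v
... | yes refl | _ = ⊥-elim (no-in (Any.map (cong proj₂ ∘ sym) uw∈B))
... | no _ | yes refl = s≤s z≤n
... | no _ | no u≢v = s≤s (inc (∈-filter⁺ (λ e → ¬? (proj₁ e ≟ v)) uw∈B u≢v))

-- Topological sorting by repeatedly removing a source: every acyclic arc
-- set has an increasing ranking with values at most its size.  The extra
-- argument k bounds the size and drives the recursion.
topological-ranking : ∀ {m} k (B : List (Arc m)) → length B ≤ k → ¬ HasDirectedCycle B →
  Σ (Fin m → ℕ) λ r → (∀ v → r v ≤ length B) × Increasing r B
topological-ranking k [] _ _ = (λ _ → 0) , (λ _ → z≤n) , λ ()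
topological-ranking (suc k) B@(e ∷ _) |B|≤k acyc with source B acyc (proj₁ e) (here refl)
... | v , no-in , out = below v r , bounded , below-increasing no-in increasing
  where
  B′ = not-leaving v B
  shorter : length B′ < length B
  shorter = filter-notAll (λ e → ¬? (proj₁ e ≟ v)) B (Any.map (λ eq ne → ne eq) out)
  rest = topological-ranking k B′ (≤-pred (≤-trans shorter |B|≤k))
           (acyc ∘ cycle-mono (λ a → proj₁ (∈-filter⁻ (λ e → ¬? (proj₁ e ≟ v)) a)))
  r = proj₁ rest
  increasing = proj₂ (proj₂ rest)
  bounded : ∀ w → below v r w ≤ length B
  bounded w with w ≟ v
  ... | yes _ = z≤n
  ... | no _ = ≤-trans (s≤s (proj₁ (proj₂ rest) w)) shorter

forward : ∀ {m} → (Fin m → ℕ) → List (Arc m) → List (Arc m)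
forward r = filter (λ e → r (proj₁ e) <? r (proj₂ e))

forward-increasing : ∀ {m} (r : Fin m → ℕ) E → Increasing r (forward r E)
forward-increasing r E a = proj₂ (∈-filter⁻ (λ e → r (proj₁ e) <? r (proj₂ e)) {xs = E} a)

forward-acyclic : (G : Digraph) (r : Fin (n G) → ℕ) → AcyclicArcSet G (forward r (arcs G))
forward-acyclic G r =
  ( filter⁺ _ (arcs-unique G)
  , All.tabulate (λ a → proj₁ (∈-filter⁻ (λ e → r (proj₁ e) <? r (proj₂ e)) a)) )
  , increasing-acyclic r (forward-increasing r (arcs G))

forward-ext : ∀ {m} (E : List (Arc m)) {r r′ : Fin m → ℕ} → (∀ v → r v ≡ r′ v) →
  length (forward r E) ≡ length (forward r′ E)
forward-ext E r≗r′ = cong length (filter-≐ _ _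
  ( (λ {e} lt → subst₂ _<_ (r≗r′ (proj₁ e)) (r≗r′ (proj₂ e)) lt)
  , (λ {e} lt → subst₂ _<_ (sym (r≗r′ (proj₁ e))) (sym (r≗r′ (proj₂ e))) lt) ) E)

forward-avoids : ∀ {m} (r : Fin m → ℕ) s E → (∀ v → r s ≤ r v) →
  All (λ e → proj₂ e ≢ s) (forward r E)
forward-avoids r s E s-min = All.tabulate λ { {u , w} a refl →
  <⇒≱ (forward-increasing r E a) (s-min u) }

acyclic⊆forward : (G : Digraph) (B : List (Arc (n G))) → AcyclicArcSet G B →
  Σ (Fin (n G) → ℕ) λ r → (∀ v → r v ≤ length (arcs G)) × length B ≤ length (forward r (arcs G))
acyclic⊆forward G B ((unique-B , B⊆E) , acyclic) =
  r , (λ v → ≤-trans (r≤|B| v) |B|≤|E|)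
    , unique-length-≤ unique-B (All.tabulate λ {e} a →
        ∈-filter⁺ (λ e → r (proj₁ e) <? r (proj₂ e)) (All.lookup B⊆E a) (increasing a))
  where
  sorted = topological-ranking (length B) B ≤-refl acyclic
  r = proj₁ sorted
  r≤|B| = proj₁ (proj₂ sorted)
  increasing = proj₂ (proj₂ sorted)
  |B|≤|E| = unique-length-≤ unique-B B⊆E

vectors : ∀ k n → List (Vec (Fin k) n)
vectors k zero = [] ∷ []
vectors k (suc n) = concatMap (λ a → map (a ∷_) (vectors k n)) (allFin k)

∈-vectors : ∀ {k n} (x : Vec (Fin k) n) → x ∈ vectors k n
∈-vectors [] = here refl
∈-vectors {k} (a ∷ x) = ∈-concatMap⁺ (λ b → map (b ∷_) (vectors k _))
  (Any.map (λ { refl → ∈-map⁺ (_ ∷_) (∈-vectors x) }) (∈-allFin a))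

-- Rankings bounded by L form a finite family, so any score that depends
-- only on the values of the ranking attains a maximum on it.
maximise : ∀ {m} (score : (Fin m → ℕ) → ℕ) →
  (∀ {r r′} → (∀ v → r v ≡ r′ v) → score r ≡ score r′) → ∀ L →
  Σ (Fin m → ℕ) λ r₀ → (∀ v → r₀ v ≤ L) × (∀ r → (∀ v → r v ≤ L) → score r ≤ score r₀)
maximise {m} score score-ext L =
  as-ranking best , (λ v → ≤-pred (toℕ<n (lookup best v))) , best-is-max
  where
  as-ranking : Vec (Fin (suc L)) m → Fin m → ℕ
  as-ranking x v = toℕ (lookup x v)
  best = argmax (score ∘ as-ranking) (replicate m Fin.zero) (vectors (suc L) m)
  best-is-max : ∀ r → (∀ v → r v ≤ L) → score r ≤ score (as-ranking best)
  best-is-max r r≤L = begin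
    score r               ≡⟨ score-ext (λ v → sym (trans (cong toℕ (lookup∘tabulate _ v)) (toℕ-fromℕ< _))) ⟩
    score (as-ranking x)  ≤⟨ All.lookup (f[xs]≤f[argmax] {f = score ∘ as-ranking} _ (vectors (suc L) m)) (∈-vectors x) ⟩
    score (as-ranking best) ∎
    where
    open ≤-Reasoning
    x = tabulate (λ v → fromℕ< (s≤s (r≤L v)))

optimal-ranking : (G : Digraph) →
  Σ (Fin (n G) → ℕ) λ r₀ → (∀ v → r₀ v ≤ length (arcs G))
    × (∀ B → AcyclicArcSet G B → length B ≤ length (forward r₀ (arcs G)))
optimal-ranking G = r₀ , r₀-bounded , λ B acyclic-B →
  let (r , r-bounded , |B|≤) = acyclic⊆forward G B acyclic-B
  in ≤-trans |B|≤ (r₀-max r r-bounded)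
  where
  E = arcs G
  opt = maximise (λ r → length (forward r E)) (forward-ext E) (length E)
  r₀ = proj₁ opt
  r₀-bounded = proj₁ (proj₂ opt)
  r₀-max = proj₂ (proj₂ opt)

-- Raise every vertex ranked below s by b (above all ranks when every
-- rank is below b), keeping the relative order of the raised vertices.
raise : ∀ {m} → (Fin m → ℕ) → Fin m → ℕ → Fin m → ℕ
raise r s b v with r v <? r s
... | yes _ = b + r v
... | no _ = r v

raise-low : ∀ {m} (r : Fin m → ℕ) s b {v} → r v < r s → raise r s b v ≡ b + r v
raise-low r s b {v} low with r v <? r s
... | yes _ = refl
... | no high = ⊥-elim (high low)

raise-high : ∀ {m} (r : Fin m → ℕ) s b {v} → ¬ r v < r s → raise r s b v ≡ r v
raise-high r s b {v} high with r v <? r s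
... | yes low = ⊥-elim (high low)
... | no _ = refl

raise-minimal : ∀ {m} (r : Fin m → ℕ) s b → r s ≤ b → ∀ v → raise r s b s ≤ raise r s b v
raise-minimal r s b rs≤b v rewrite raise-high r s b (<-irrefl refl) with r v <? r s
... | yes _ = ≤-trans rs≤b (m≤m+n b (r v))
... | no high = ≮⇒≥ high

-- Effect of raising on a single arc u → w, with "low" meaning ranked below
-- s: the arc gains forward status exactly when it enters the low set and
-- loses it exactly when it leaves the low set.
raise-arc : ∀ {m} (r : Fin m → ℕ) s b → (∀ v → r v < b) → ∀ u w →
  (u-low? : Dec (r u < r s)) (w-low? : Dec (r w < r s)) →
  ind (r u <? r w) + ind w-low? ≡ ind (raise r s b u <? raise r s b w) + ind u-low?
raise-arc r s b r<b u w (yes u-low) (yes w-low)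
  rewrite raise-low r s b u-low | raise-low r s b w-low =
  cong (_+ 1) (ind-cong (+-monoʳ-< b) (+-cancelˡ-< b (r u) (r w)) (r u <? r w) (b + r u <? b + r w))
raise-arc r s b r<b u w (yes u-low) (no w-high)
  rewrite raise-low r s b u-low | raise-high r s b w-high
        | ind-yes (r u <? r w) (<-≤-trans u-low (≮⇒≥ w-high))
        | ind-no (b + r u <? r w) (λ lt → m+n≮m b (r u) (<-trans lt (r<b w))) = refl
raise-arc r s b r<b u w (no u-high) (yes w-low)
  rewrite raise-high r s b u-high | raise-low r s b w-low
        | ind-no (r u <? r w) (λ lt → u-high (<-trans lt w-low))
        | ind-yes (r u <? b + r w) (<-≤-trans (r<b u) (m≤m+n b (r w))) = refl
raise-arc r s b r<b u w (no u-high) (no w-high)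
  rewrite raise-high r s b u-high | raise-high r s b w-high = refl

-- In an Eulerian digraph raising does not change the number of forward
-- arcs: the arcs entering and leaving the low set are equinumerous.
raise-forward : (G : Digraph) → Eulerian G → (r : Fin (n G) → ℕ) (s : Fin (n G)) (b : ℕ) →
  (∀ v → r v < b) → length (forward r (arcs G)) ≡ length (forward (raise r s b) (arcs G))
raise-forward G eul r s b r<b = +-cancelʳ-≡ _ _ _ (begin
  length (forward r E) + count (λ e → low (proj₂ e)) E
    ≡⟨ count-balance _ (λ e → low (proj₂ e)) _ (λ e → low (proj₁ e))
                     (λ (u , w) → raise-arc r s b r<b u w (low u) (low w)) E ⟩
  length (forward (raise r s b) E) + count (λ e → low (proj₁ e)) E
    ≡⟨ cong (length (forward (raise r s b) E) +_) (sym (eulerian-cut G eul low)) ⟩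
  length (forward (raise r s b) E) + count (λ e → low (proj₂ e)) E ∎)
  where
  open ≡-Reasoning
  E = arcs G
  low : ∀ v → Dec (r v < r s)
  low v = r v <? r s

theorem1 : (G : Digraph) → Connected G → Eulerian G →
    (s : Fin (n G)) →
    Σ (List (Arc (n G))) λ A →
      AcyclicArcSet G A
      × All (λ e → proj₂ e ≢ s) A
      × (∀ B → AcyclicArcSet G B → length B ≤ length A)
theorem1 G _ eul s =
  forward r* E , forward-acyclic G r* ,
  forward-avoids r* s E (raise-minimal r₀ s b (m≤n⇒m≤1+n (r₀-bounded s))) ,
  λ B acyclic-B → ≤-trans (r₀-max B acyclic-B) (≤-reflexive (raise-forward G eul r₀ s b r₀<b))
  where
  E : List (Arc (n G))
  E = arcs G
  b : ℕ
  b = suc (length E)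
  opt = optimal-ranking G
  r₀ : Fin (n G) → ℕ
  r₀ = proj₁ opt
  r₀-bounded : ∀ v → r₀ v ≤ length E
  r₀-bounded = proj₁ (proj₂ opt)
  r₀-max : ∀ B → AcyclicArcSet G B → length B ≤ length (forward r₀ E)
  r₀-max = proj₂ (proj₂ opt)
  r₀<b : ∀ v → r₀ v < b
  r₀<b v = s≤s (r₀-bounded v)
  r* : Fin (n G) → ℕ
  r* = raise r₀ s b
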